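{- For any two polytopes $[P],[Q]\in\mathcal P$ we have $D([P]+[Q])=D([P])\boxplus D([Q])$, where for vector configurations $T,U$, $$T\boxplus U=\{v+w: v\in T,\ w\in U,\ \mathrm{cone}(v)=\mathrm{cone}(w)\}\cup\{v\in T:\mathrm{cone}(v)\cap U=\emptyset\}\cup\{w\in U:\mathrm{cone}(w)\cap T=\emptyset\}.$$
   Context: Let $\Lambda=\mathbb Z^3/\mathbb Z(1,1,1)$, $V=\Lambda\otimes_{\mathbb Z}\mathbb R$. A lattice polytope in $V$ is the convex hull of finitely many points of $\Lambda$; $\mathcal P$ is the set of translation classes $[P]$ (under translation by $\Lambda$) of non-empty lattice polytopes in $V$, and $[P]+[Q]=[P+Q]$ (Minkowski sum). Let $\Lambda^*=\mathrm{Hom}_{\mathbb Z}(\Lambda,\mathbb Z)$, $V^*=\mathrm{Hom}_{\mathbb R}(V,\mathbb R)$. For $v\in V^*\setminus\{0\}$ let $S(P,v)=\{x\in P: v(x)=\max_{y\in P}v(y)\}$ and $S([P],v)=[S(P,v)]$. A nonzero lattice vector is primitive if it is not an integer multiple $\lambda y$, $\lambda\ge2$, of a lattice vector $y$; each nonzero lattice vector is uniquely $\lambda\hat x$ with $\hat x$ primitive, $\lambda\in\mathbb Z_{>0}$, and its lattice length is $\ell(x)=\lambda$; the lattice length of a segment $\mathrm{conv}(a,b)$ is $\ell(b-a)$. A vector configuration is a finite set of nonzero vectors in $V^*$ no two of which lie on the same ray ($v_i\notin\mathrm{cone}(v_j)$ for $i\ne j$). $D([P])$ is the set of all $v\in\Lambda^*\setminus\{0\}$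 such that $S([P],v)$ is an edge of lattice length $\ell(v)$. -}

module Defs where

open import Data.Nat using (ℕ; suc; _≤_; _<_)
open import Data.Integer using (ℤ; +_; _+_; _-_; _*_) renaming (_≤_ to _≤ℤ_)
open import Data.Product using (_×_; _,_; ∃; ∃-syntax; Σ)
open import Data.Sum using (_⊎_)
open import Data.List using (List)
open import Data.List.NonEmpty using (List⁺; toList; _∷_)
import Data.List.NonEmpty as L⁺
open import Data.List.Membership.Propositional using (_∈_)
open import Relation.Nullary using (¬_)
open import Relation.Binary.PropositionalEquality using (_≡_)

-- A point of Λ = ℤ³/ℤ(1,1,1) is represented by a
-- triple (any representative); a point of Λ* = Hom(Λ,ℤ) is a triple with
-- coordinate sum 0 (the functionals on ℤ³ vanishing on (1,1,1)).
record Z3 : Set where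
  constructor ⟨_,_,_⟩
  field
    c₁ c₂ c₃ : ℤ
open Z3 public

_⊕_ : Z3 → Z3 → Z3
⟨ a , b , c ⟩ ⊕ ⟨ x , y , z ⟩ = ⟨ a + x , b + y , c + z ⟩

_⊖_ : Z3 → Z3 → Z3
⟨ a , b , c ⟩ ⊖ ⟨ x , y , z ⟩ = ⟨ a - x , b - y , c - z ⟩

_•_ : ℕ → Z3 → Z3
n • ⟨ a , b , c ⟩ = ⟨ + n * a , + n * b , + n * c ⟩

zero3 : Z3
zero3 = ⟨ + 0 , + 0 , + 0 ⟩

-- equality in Λ of two representatives: difference lies in ℤ(1,1,1)
_∼_ : Z3 → Z3 → Set
x ∼ y = let d = x ⊖ y in (c₁ d ≡ c₂ d) × (c₂ d ≡ c₃ d)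

PrimitiveΛ : Z3 → Set
PrimitiveΛ y = ¬ (y ∼ zero3) × ¬ (∃[ μ ] ∃[ z ] (2 ≤ μ × y ∼ (μ • z)))

LatticeLengthΛ : Z3 → ℕ → Set
LatticeLengthΛ w k = 1 ≤ k × ∃[ y ] (PrimitiveΛ y × w ∼ (k • y))

InΛ* : Z3 → Set
InΛ* v = c₁ v + c₂ v + c₃ v ≡ + 0

-- evaluation v(x) (well defined on Λ since v vanishes on (1,1,1))
⟪_,_⟫ : Z3 → Z3 → ℤ
⟪ v , x ⟫ = c₁ v * c₁ x + c₂ v * c₂ x + c₃ v * c₃ x

PrimitiveΛ* : Z3 → Set
PrimitiveΛ* u = InΛ* u × ¬ (u ≡ zero3)
  × ¬ (∃[ μ ] ∃[ z ] (2 ≤ μ × InΛ* z × u ≡ (μ • z)))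

LatticeLengthΛ* : Z3 → ℕ → Set
LatticeLengthΛ* v k = 1 ≤ k × ∃[ u ] (PrimitiveΛ* u × v ≡ (k • u))

-- A lattice polytope P = conv(A) is given by a
-- non-empty finite list A of lattice points (representatives in ℤ³).
-- Everything below is invariant under translation by Λ, so it is a
-- function of the class [P].

Polytope : Set
Polytope = List⁺ Z3

-- Minkowski sum: conv(A) + conv(B) = conv(A + B)
_⊞P_ : Polytope → Polytope → Polytope
A ⊞P B = L⁺.concatMap (λ a → L⁺.map (a ⊕_) B) A

-- a ∈ A attains max_{y ∈ conv A} v(y)  (i.e. a ∈ S(P,v) ∩ A)
IsMaxPt : Z3 → Polytope → Z3 → Set
IsMaxPt v A a = a ∈ toList A × (∀ a' → a' ∈ toList A → ⟪ v , a' ⟫ ≤ℤ ⟪ v , a ⟫)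

-- c lies in the real segment conv(a,b) in V (a ≁ b):
--   c - a = t (b - a) with t = p/q ∈ [0,1]  (t is necessarily rational)
InSegment : Z3 → Z3 → Z3 → Set
InSegment c a b = ∃[ p ] ∃[ q ] (0 < q × p ≤ q × (q • (c ⊖ a)) ∼ (p • (b ⊖ a)))

-- Since S(conv A, v) is the
-- convex hull of the points of A attaining the maximum, it is a segment
-- conv(a,b) (a ≠ b in Λ) iff such a,b exist among those points with all
-- other maximal points between them.
EdgeOfLength : Polytope → Z3 → Set
EdgeOfLength A v =
  ∃[ a ] ∃[ b ] (IsMaxPt v A a × IsMaxPt v A b × ¬ (a ∼ b)
    × (∀ c → IsMaxPt v A c → InSegment c a b)
    × ∃[ k ] (LatticeLengthΛ (b ⊖ a) k × LatticeLengthΛ* v k))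

D : Polytope → Z3 → Set
D A v = InΛ* v × ¬ (v ≡ zero3) × EdgeOfLength A v

-- u ∈ cone(v) = { t v : t ≥ 0 }  (t rational = q/p for integer vectors)
InCone : Z3 → Z3 → Set
InCone u v = ∃[ p ] ∃[ q ] (0 < p × (p • u) ≡ (q • v))

SameCone : Z3 → Z3 → Set
SameCone v w = InCone v w × InCone w v

_⊞_ : (Z3 → Set) → (Z3 → Set) → Z3 → Set
(T ⊞ U) x =
    (∃[ v ] ∃[ w ] (T v × U w × SameCone v w × x ≡ (v ⊕ w)))
  ⊎ (T x × (∀ w → U w → ¬ InCone w x))
  ⊎ (U x × (∀ v → T v → ¬ InCone v x))

-- For a primitive u ∈ Λ*, the face S(P, u) is a lattice segment, possibly a
-- point, parallel to the rank-one lattice ker u; let w_u(P) be its lattice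
-- length.  For k ≥ 1 we have S(P, k u) = S(P, u) and ℓ(k u) = k, so
-- k u ∈ D(P) iff w_u(P) = k.  Faces add under Minkowski sums,
-- S(P + Q, u) = S(P, u) + S(Q, u), hence w_u(P + Q) = w_u(P) + w_u(Q); the
-- three parts of D(P) ⊞ D(Q) are the cases where both, only the first, or
-- only the second of w_u(P), w_u(Q) is positive.

module Submission where

open import Defs
open import Data.Empty using (⊥-elim)
open import Data.Integer as ℤ using (ℤ; +_; -[1+_]; _+_; _-_; _*_; -_; ∣_∣; 0ℤ; 1ℤ)
import Data.Integer.Divisibility.Signed as ℤDiv
import Data.Integer.Properties as ℤP
open import Data.Integer.Tactic.RingSolver using (solve-∀)
open import Data.List as List using ([]; _∷_)
import Data.List.Extrema
open import Data.List.Membership.Propositional using (_∈_)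
open import Data.List.Membership.Propositional.Properties
  using (∈-cartesianProductWith⁺; ∈-cartesianProductWith⁻)
open import Data.List.NonEmpty as List⁺ using (toList; _∷_)
import Data.List.Relation.Unary.All as All
open import Data.List.Relation.Unary.Any using (here; there)
open import Data.Nat as ℕ using (ℕ; zero; suc; z≤n; s≤s)
import Data.Nat.Divisibility as ℕDiv
import Data.Nat.GCD as ℕGCD
import Data.Nat.Properties as ℕP
open import Data.Product using (_×_; _,_; ∃-syntax; Σ-syntax; proj₁; proj₂)
open import Data.Product.Relation.Binary.Lex.NonStrict using (×-totalOrder)
open import Data.Sum using (inj₁; inj₂)
open import Relation.Nullary using (¬_)
open import Relation.Binary.Bundles using (TotalOrder)
open import Relation.Binary.PropositionalEquality

-- An equation L ≡ R follows from hypotheses Aᵢ ≡ Bᵢ once L - R is a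
-- combination Σ kᵢ * (Aᵢ - Bᵢ); the ring solver certifies the combination.
lincomb₁ : ∀ {L R A₁ B₁ : ℤ} k₁ → L - R ≡ k₁ * (A₁ - B₁) → A₁ ≡ B₁ → L ≡ R
lincomb₁ {L} {R} {A₁} k₁ e refl = ℤP.i-j≡0⇒i≡j L R (trans e (vanish k₁ A₁))
  where
  vanish : ∀ k a → k * (a - a) ≡ 0ℤ
  vanish = solve-∀

lincomb₂ : ∀ {L R A₁ B₁ A₂ B₂ : ℤ} k₁ k₂ → L - R ≡ k₁ * (A₁ - B₁) + k₂ * (A₂ - B₂) →
           A₁ ≡ B₁ → A₂ ≡ B₂ → L ≡ R
lincomb₂ {L} {R} {A₁} {_} {A₂} k₁ k₂ e refl refl = ℤP.i-j≡0⇒i≡j L R (trans e (vanish k₁ k₂ A₁ A₂))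
  where
  vanish : ∀ k₁ k₂ a₁ a₂ → k₁ * (a₁ - a₁) + k₂ * (a₂ - a₂) ≡ 0ℤ
  vanish = solve-∀

lincomb₃ : ∀ {L R A₁ B₁ A₂ B₂ A₃ B₃ : ℤ} k₁ k₂ k₃ →
           L - R ≡ k₁ * (A₁ - B₁) + k₂ * (A₂ - B₂) + k₃ * (A₃ - B₃) →
           A₁ ≡ B₁ → A₂ ≡ B₂ → A₃ ≡ B₃ → L ≡ R
lincomb₃ {L} {R} {A₁} {_} {A₂} {_} {A₃} k₁ k₂ k₃ e refl refl refl =
  ℤP.i-j≡0⇒i≡j L R (trans e (vanish k₁ k₂ k₃ A₁ A₂ A₃))
  where
  vanish : ∀ k₁ k₂ k₃ a₁ a₂ a₃ → k₁ * (a₁ - a₁) + k₂ * (a₂ - a₂) + k₃ * (a₃ - a₃) ≡ 0ℤ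
  vanish = solve-∀

2≤m⇒1≢m*n : ∀ {m} n → 2 ℕ.≤ m → 1 ≢ m ℕ.* n
2≤m⇒1≢m*n {m} n 2≤m 1≡m*n =
  ℕP.<⇒≢ 2≤m (sym (ℕDiv.∣1⇒≡1 (ℕDiv.divides n (trans 1≡m*n (ℕP.*-comm m n)))))

+∣i∣≡±i : ∀ i → ∃[ σ ] (+ ∣ i ∣ ≡ σ * i)
+∣i∣≡±i (+ n)    = 1ℤ , sym (ℤP.*-identityˡ (+ n))
+∣i∣≡±i -[1+ n ] = - 1ℤ , sym (neg-neg (+ suc n))
  where
  neg-neg : ∀ i → (- 1ℤ) * (- i) ≡ i
  neg-neg = solve-∀

i≤j⇒j-i≡+∣j-i∣ : ∀ {i j} → i ℤ.≤ j → j - i ≡ + ∣ j - i ∣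
i≤j⇒j-i≡+∣j-i∣ i≤j = sym (ℤP.0≤i⇒+∣i∣≡i (ℤP.i≤j⇒0≤j-i i≤j))

+-cancelʳ-≤ : ∀ {i j} k → i + k ℤ.≤ j + k → i ℤ.≤ j
+-cancelʳ-≤ {i} {j} k i+k≤j+k =
  subst₂ ℤ._≤_ (add-sub i k) (add-sub j k) (ℤP.+-monoˡ-≤ (- k) i+k≤j+k)
  where
  add-sub : ∀ i k → i + k + - k ≡ i
  add-sub = solve-∀

+-cancelˡ-≤ : ∀ {i j} k → k + i ℤ.≤ k + j → i ℤ.≤ j
+-cancelˡ-≤ {i} {j} k k+i≤k+j =
  +-cancelʳ-≤ k (subst₂ ℤ._≤_ (ℤP.+-comm k i) (ℤP.+-comm k j) k+i≤k+j)

ConvexCombination : ℤ → ℤ → ℤ → Set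
ConvexCombination c a b = ∃[ p ] ∃[ q ] (0 ℕ.< q × p ℕ.≤ q × + q * (c - a) ≡ + p * (b - a))

between : ∀ {a b c} → ConvexCombination c a b → a ℤ.≤ b → a ℤ.≤ c × c ℤ.≤ b
between {a} {b} {c} (p , suc q , _ , p≤q , q[c-a]≡p[b-a]) a≤b =
  ℤP.0≤i-j⇒j≤i 0≤c-a , +-cancelʳ-≤ (- a) c-a≤b-a
  where
  0≤b-a : 0ℤ ℤ.≤ b - a
  0≤b-a = ℤP.i≤j⇒0≤j-i a≤b
  0≤c-a : 0ℤ ℤ.≤ c - a
  0≤c-a = ℤP.*-cancelˡ-≤-pos 0ℤ (c - a) (+ suc q)
    (subst₂ ℤ._≤_ (sym (ℤP.*-zeroʳ (+ suc q))) (sym q[c-a]≡p[b-a])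
      (subst (ℤ._≤ + p * (b - a)) (ℤP.*-zeroʳ (+ p)) (ℤP.*-monoˡ-≤-nonNeg (+ p) 0≤b-a)))
  c-a≤b-a : c - a ℤ.≤ b - a
  c-a≤b-a = ℤP.*-cancelˡ-≤-pos (c - a) (b - a) (+ suc q)
    (subst (ℤ._≤ + suc q * (b - a)) (sym q[c-a]≡p[b-a])
      (ℤP.*-monoʳ-≤-nonNeg (b - a) {{ℤ.nonNegative 0≤b-a}} (ℤ.+≤+ p≤q)))

ConvexCombination-neg : ∀ {a b c} → ConvexCombination c a b → ConvexCombination (- c) (- a) (- b)
ConvexCombination-neg {a} {b} {c} (p , q , 0<q , p≤q , q[c-a]≡p[b-a]) =
  p , q , 0<q , p≤q , trans (negate (+ q) c a) (trans (cong -_ q[c-a]≡p[b-a]) (sym (negate (+ p) b a)))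
  where
  negate : ∀ k x y → k * (- x - - y) ≡ - (k * (x - y))
  negate = solve-∀

between-reversed : ∀ {a b c} → ConvexCombination c a b → b ℤ.≤ a → b ℤ.≤ c × c ℤ.≤ a
between-reversed {a} {b} {c} c∈[a,b] b≤a
  with -a≤-c , -c≤-b ← between { - a} { - b} { - c} (ConvexCombination-neg {a} {b} {c} c∈[a,b]) (ℤP.neg-mono-≤ b≤a) =
  ℤP.neg-cancel-≤ -c≤-b , ℤP.neg-cancel-≤ -a≤-c

⟨,,⟩-cong : ∀ {a b c a′ b′ c′} → a ≡ a′ → b ≡ b′ → c ≡ c′ → ⟨ a , b , c ⟩ ≡ ⟨ a′ , b′ , c′ ⟩
⟨,,⟩-cong refl refl refl = refl

•-assoc : ∀ m n x → m • (n • x) ≡ (m ℕ.* n) • x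
•-assoc m n ⟨ a , b , c ⟩ = ⟨,,⟩-cong (assoc a) (assoc b) (assoc c)
  where
  assoc : ∀ a → + m * (+ n * a) ≡ + (m ℕ.* n) * a
  assoc a = trans (sym (ℤP.*-assoc (+ m) (+ n) a)) (cong (_* a) (sym (ℤP.pos-* m n)))

•-comm : ∀ m n x → m • (n • x) ≡ n • (m • x)
•-comm m n x = begin
  m • (n • x)     ≡⟨ •-assoc m n x ⟩
  (m ℕ.* n) • x   ≡⟨ cong (_• x) (ℕP.*-comm m n) ⟩
  (n ℕ.* m) • x   ≡⟨ •-assoc n m x ⟨
  n • (m • x)     ∎
  where open ≡-Reasoning

•-distribʳ-+ : ∀ m n x → (m ℕ.+ n) • x ≡ (m • x) ⊕ (n • x)
•-distribʳ-+ m n ⟨ a , b , c ⟩ = ⟨,,⟩-cong (distrib a) (distrib b) (distrib c)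
  where
  distrib : ∀ a → + (m ℕ.+ n) * a ≡ + m * a + + n * a
  distrib a = trans (cong (_* a) (ℤP.pos-+ m n)) (ℤP.*-distribʳ-+ a (+ m) (+ n))

•-≢zero3 : ∀ {n x} → 1 ℕ.≤ n → x ≢ zero3 → n • x ≢ zero3
•-≢zero3 {suc n} {⟨ a , b , c ⟩} _ x≢0 n•x≡0 =
  x≢0 (⟨,,⟩-cong (cancel (cong c₁ n•x≡0)) (cancel (cong c₂ n•x≡0)) (cancel (cong c₃ n•x≡0)))
  where
  cancel : ∀ {a} → + suc n * a ≡ 0ℤ → a ≡ 0ℤ
  cancel {a} eq = ℤP.*-cancelˡ-≡ (+ suc n) a 0ℤ (trans eq (sym (ℤP.*-zeroʳ (+ suc n))))

InΛ*-• : ∀ n {v} → InΛ* v → InΛ* (n • v)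
InΛ*-• n {⟨ a , b , c ⟩} a+b+c≡0 =
  trans (factor (+ n) a b c) (trans (cong (+ n *_) a+b+c≡0) (ℤP.*-zeroʳ (+ n)))
  where
  factor : ∀ m a b c → m * a + m * b + m * c ≡ m * (a + b + c)
  factor = solve-∀

⟪⟫-•ˡ : ∀ n v x → ⟪ n • v , x ⟫ ≡ + n * ⟪ v , x ⟫
⟪⟫-•ˡ n ⟨ a , b , c ⟩ ⟨ p , q , r ⟩ = factor (+ n) a b c p q r
  where
  factor : ∀ m a b c p q r → m * a * p + m * b * q + m * c * r ≡ m * (a * p + b * q + c * r)
  factor = solve-∀

⟪⟫-•ʳ : ∀ n v x → ⟪ v , n • x ⟫ ≡ + n * ⟪ v , x ⟫
⟪⟫-•ʳ n ⟨ a , b , c ⟩ ⟨ p , q , r ⟩ = factor (+ n) a b c p q r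
  where
  factor : ∀ m a b c p q r → a * (m * p) + b * (m * q) + c * (m * r) ≡ m * (a * p + b * q + c * r)
  factor = solve-∀

⟪⟫-⊕ : ∀ v x y → ⟪ v , x ⊕ y ⟫ ≡ ⟪ v , x ⟫ + ⟪ v , y ⟫
⟪⟫-⊕ ⟨ a , b , c ⟩ ⟨ p , q , r ⟩ ⟨ p′ , q′ , r′ ⟩ = distrib a b c p q r p′ q′ r′
  where
  distrib : ∀ a b c p q r p′ q′ r′ →
            a * (p + p′) + b * (q + q′) + c * (r + r′) ≡ (a * p + b * q + c * r) + (a * p′ + b * q′ + c * r′)
  distrib = solve-∀

⟪⟫-⊖ : ∀ v x y → ⟪ v , x ⊖ y ⟫ ≡ ⟪ v , x ⟫ - ⟪ v , y ⟫
⟪⟫-⊖ ⟨ a , b , c ⟩ ⟨ p , q , r ⟩ ⟨ p′ , q′ , r′ ⟩ = distrib a b c p q r p′ q′ r′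
  where
  distrib : ∀ a b c p q r p′ q′ r′ →
            a * (p - p′) + b * (q - q′) + c * (r - r′) ≡ (a * p + b * q + c * r) - (a * p′ + b * q′ + c * r′)
  distrib = solve-∀

-- Coordinates identifying Λ = ℤ³/ℤ(1,1,1) with ℤ².
X Y : Z3 → ℤ
X x = c₁ x - c₃ x
Y x = c₂ x - c₃ x

∼⇒XY≡ : ∀ x y → x ∼ y → X x ≡ X y × Y x ≡ Y y
∼⇒XY≡ ⟨ a , b , c ⟩ ⟨ p , q , r ⟩ (h₁ , h₂) =
  lincomb₂ 1ℤ 1ℤ (X-diff a b c p q r) h₁ h₂ , lincomb₂ 0ℤ 1ℤ (Y-diff a b c p q r) h₁ h₂
  where
  X-diff : ∀ a b c p q r → (a - c) - (p - r) ≡ 1ℤ * ((a - p) - (b - q)) + 1ℤ * ((b - q) - (c - r))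
  X-diff = solve-∀
  Y-diff : ∀ a b c p q r → (b - c) - (q - r) ≡ 0ℤ * ((a - p) - (b - q)) + 1ℤ * ((b - q) - (c - r))
  Y-diff = solve-∀

XY≡⇒∼ : ∀ x y → X x ≡ X y → Y x ≡ Y y → x ∼ y
XY≡⇒∼ ⟨ a , b , c ⟩ ⟨ p , q , r ⟩ h₁ h₂ =
  lincomb₂ 1ℤ (- 1ℤ) (diff₁₂ a b c p q r) h₁ h₂ , lincomb₂ 0ℤ 1ℤ (diff₂₃ a b c p q r) h₁ h₂
  where
  diff₁₂ : ∀ a b c p q r → (a - p) - (b - q) ≡ 1ℤ * ((a - c) - (p - r)) + (- 1ℤ) * ((b - c) - (q - r))
  diff₁₂ = solve-∀
  diff₂₃ : ∀ a b c p q r → (b - q) - (c - r) ≡ 0ℤ * ((a - c) - (p - r)) + 1ℤ * ((b - c) - (q - r))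
  diff₂₃ = solve-∀

⟪⟫-XY : ∀ v x → InΛ* v → ⟪ v , x ⟫ ≡ c₁ v * X x + c₂ v * Y x
⟪⟫-XY ⟨ a , b , c ⟩ ⟨ p , q , r ⟩ a+b+c≡0 = lincomb₁ r (eliminate-c a b c p q r) a+b+c≡0
  where
  eliminate-c : ∀ a b c p q r →
                (a * p + b * q + c * r) - (a * (p - r) + b * (q - r)) ≡ r * ((a + b + c) - 0ℤ)
  eliminate-c = solve-∀

⟪⟫-∼ : ∀ v {x y} → InΛ* v → x ∼ y → ⟪ v , x ⟫ ≡ ⟪ v , y ⟫
⟪⟫-∼ v {x} {y} v∈Λ* x∼y = begin
  ⟪ v , x ⟫                  ≡⟨ ⟪⟫-XY v x v∈Λ* ⟩
  c₁ v * X x + c₂ v * Y x    ≡⟨ cong₂ (λ p q → c₁ v * p + c₂ v * q) (proj₁ (∼⇒XY≡ x y x∼y)) (proj₂ (∼⇒XY≡ x y x∼y)) ⟩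
  c₁ v * X y + c₂ v * Y y    ≡⟨ ⟪⟫-XY v y v∈Λ* ⟨
  ⟪ v , y ⟫                  ∎
  where open ≡-Reasoning

-- A functional in Λ* is fixed by its first two coordinates, so it is
-- primitive exactly when these are coprime.
Bezout : Z3 → Set
Bezout u = Σ[ s ∈ ℤ ] Σ[ r ∈ ℤ ] s * c₁ u + r * c₂ u ≡ 1ℤ

InΛ*-zero : ∀ u → InΛ* u → c₁ u ≡ 0ℤ → c₂ u ≡ 0ℤ → u ≡ zero3
InΛ*-zero ⟨ a , b , c ⟩ 0+0+c≡0 refl refl = ⟨,,⟩-cong refl refl (trans (sym (ℤP.+-identityˡ c)) 0+0+c≡0)

InΛ*-divisible : ∀ u g → InΛ* u → g ℕDiv.∣ ∣ c₁ u ∣ → g ℕDiv.∣ ∣ c₂ u ∣ →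
                 ∃[ z ] (InΛ* z × u ≡ g • z)
InΛ*-divisible ⟨ a , b , c ⟩ g a+b+c≡0 g∣a g∣b
  with ℤDiv.divides q₁ a≡q₁g ← ℤDiv.∣ᵤ⇒∣ {+ g} {a} g∣a
     | ℤDiv.divides q₂ b≡q₂g ← ℤDiv.∣ᵤ⇒∣ {+ g} {b} g∣b =
  ⟨ q₁ , q₂ , - q₁ - q₂ ⟩ , sum-zero q₁ q₂ , ⟨,,⟩-cong a≡gq₁ b≡gq₂ c≡g[-q₁-q₂]
  where
  sum-zero : ∀ a b → a + b + (- a - b) ≡ 0ℤ
  sum-zero = solve-∀
  a≡gq₁ : a ≡ + g * q₁
  a≡gq₁ = trans a≡q₁g (ℤP.*-comm q₁ (+ g))
  b≡gq₂ : b ≡ + g * q₂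
  b≡gq₂ = trans b≡q₂g (ℤP.*-comm q₂ (+ g))
  third : ∀ a b c g q₁ q₂ →
          c - g * (- q₁ - q₂) ≡ 1ℤ * ((a + b + c) - 0ℤ) + (- 1ℤ) * (a - g * q₁) + (- 1ℤ) * (b - g * q₂)
  third = solve-∀
  c≡g[-q₁-q₂] : c ≡ + g * (- q₁ - q₂)
  c≡g[-q₁-q₂] = lincomb₃ 1ℤ (- 1ℤ) (- 1ℤ) (third a b c (+ g) q₁ q₂) a+b+c≡0 a≡gq₁ b≡gq₂

primitive⇒GCD≡1 : ∀ {u d} → PrimitiveΛ* u → ℕGCD.GCD ∣ c₁ u ∣ ∣ c₂ u ∣ d → d ≡ 1
primitive⇒GCD≡1 {u} {0} (u∈Λ* , u≢0 , _) gcd =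
  ⊥-elim (u≢0 (InΛ*-zero u u∈Λ* (ℤP.∣i∣≡0⇒i≡0 (ℕDiv.0∣⇒≡0 (ℕGCD.GCD.gcd∣m gcd)))
                                 (ℤP.∣i∣≡0⇒i≡0 (ℕDiv.0∣⇒≡0 (ℕGCD.GCD.gcd∣n gcd)))))
primitive⇒GCD≡1 {u} {1} _ _ = refl
primitive⇒GCD≡1 {u} {suc (suc g)} (u∈Λ* , _ , u-indivisible) gcd
  with z , z∈Λ* , u≡g•z ← InΛ*-divisible u (suc (suc g)) u∈Λ* (ℕGCD.GCD.gcd∣m gcd) (ℕGCD.GCD.gcd∣n gcd) =
  ⊥-elim (u-indivisible (suc (suc g) , z , s≤s (s≤s z≤n) , z∈Λ* , u≡g•z))

bézout-ℤ : ∀ {m n} → ℕGCD.Bézout.Identity 1 m n → Σ[ s ∈ ℤ ] Σ[ r ∈ ℤ ] s * + m + r * + n ≡ 1ℤ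
bézout-ℤ {m} {n} (ℕGCD.Bézout.+- x y 1+yn≡xm) =
  + x , - + y , lincomb₁ (- 1ℤ) (rearrange (+ x) (+ y) (+ m) (+ n)) (cast 1+yn≡xm)
  where
  rearrange : ∀ x y m n → (x * m + (- y) * n) - 1ℤ ≡ (- 1ℤ) * ((1ℤ + y * n) - x * m)
  rearrange = solve-∀
  cast : 1 ℕ.+ y ℕ.* n ≡ x ℕ.* m → 1ℤ + + y * + n ≡ + x * + m
  cast eq = begin
    1ℤ + + y * + n       ≡⟨ cong (λ t → 1ℤ + t) (ℤP.pos-* y n) ⟨
    + (1 ℕ.+ y ℕ.* n)    ≡⟨ cong +_ eq ⟩
    + (x ℕ.* m)          ≡⟨ ℤP.pos-* x m ⟩
    + x * + m            ∎
    where open ≡-Reasoning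
bézout-ℤ {m} {n} (ℕGCD.Bézout.-+ x y 1+xm≡yn)
  with s , r , eq ← bézout-ℤ (ℕGCD.Bézout.+- y x 1+xm≡yn) =
  r , s , trans (ℤP.+-comm (r * + m) (s * + n)) eq

primitive⇒bezout : ∀ {u} → PrimitiveΛ* u → Bezout u
primitive⇒bezout {u} u-prim
  with d , gcd ← ℕGCD.mkGCD ∣ c₁ u ∣ ∣ c₂ u ∣
  with s , r , eq ← bézout-ℤ (ℕGCD.Bézout.identity (subst (ℕGCD.GCD _ _) (primitive⇒GCD≡1 u-prim gcd) gcd))
     | σ₁ , ∣u₁∣≡σ₁u₁ ← +∣i∣≡±i (c₁ u)
     | σ₂ , ∣u₂∣≡σ₂u₂ ← +∣i∣≡±i (c₂ u) =
  s * σ₁ , r * σ₂ , trans (reassociate s r σ₁ σ₂ (c₁ u) (c₂ u))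
                          (subst₂ (λ p q → s * p + r * q ≡ 1ℤ) ∣u₁∣≡σ₁u₁ ∣u₂∣≡σ₂u₂ eq)
  where
  reassociate : ∀ s r σ₁ σ₂ a b → s * σ₁ * a + r * σ₂ * b ≡ s * (σ₁ * a) + r * (σ₂ * b)
  reassociate = solve-∀

•-cancelˡ : ∀ {k x y} → 1 ℕ.≤ k → k • x ≡ k • y → x ≡ y
•-cancelˡ {suc k} {⟨ a , b , c ⟩} {⟨ p , q , r ⟩} _ k•x≡k•y =
  ⟨,,⟩-cong (cancel (cong c₁ k•x≡k•y)) (cancel (cong c₂ k•x≡k•y)) (cancel (cong c₃ k•x≡k•y))
  where
  cancel : ∀ {i j} → + suc k * i ≡ + suc k * j → i ≡ j
  cancel {i} {j} = ℤP.*-cancelˡ-≡ (+ suc k) i j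

bezout-•-∣ : ∀ {k k′ u u′} → Bezout u → k • u ≡ k′ • u′ → k′ ℕDiv.∣ k
bezout-•-∣ {k} {k′} {⟨ a , b , c ⟩} {⟨ a′ , b′ , c′ ⟩} (s , r , sa+rb≡1) k•u≡k′•u′ =
  ℕDiv.divides ∣ t ∣ (begin
    k               ≡⟨ cong ∣_∣ k≡k′t ⟩
    ∣ + k′ * t ∣    ≡⟨ ℤP.abs-* (+ k′) t ⟩
    k′ ℕ.* ∣ t ∣    ≡⟨ ℕP.*-comm k′ ∣ t ∣ ⟩
    ∣ t ∣ ℕ.* k′    ∎)
  where
  open ≡-Reasoning
  t : ℤ
  t = s * a′ + r * b′
  distribute : ∀ k s r a b → k * (s * a + r * b) ≡ s * (k * a) + r * (k * b)
  distribute = solve-∀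
  e₁ : + k * a ≡ + k′ * a′
  e₁ = cong c₁ k•u≡k′•u′
  e₂ : + k * b ≡ + k′ * b′
  e₂ = cong c₂ k•u≡k′•u′
  k≡k′t : + k ≡ + k′ * t
  k≡k′t = begin
    + k                                     ≡⟨ ℤP.*-identityʳ (+ k) ⟨
    + k * 1ℤ                                ≡⟨ cong (+ k *_) sa+rb≡1 ⟨
    + k * (s * a + r * b)                   ≡⟨ distribute (+ k) s r a b ⟩
    s * (+ k * a) + r * (+ k * b)           ≡⟨ cong₂ (λ p q → s * p + r * q) e₁ e₂ ⟩
    s * (+ k′ * a′) + r * (+ k′ * b′)       ≡⟨ distribute (+ k′) s r a′ b′ ⟨
    + k′ * t                                ∎

primitive-•-unique : ∀ {k k′ u u′} → PrimitiveΛ* u → PrimitiveΛ* u′ → 1 ℕ.≤ k →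
                     k • u ≡ k′ • u′ → k ≡ k′ × u ≡ u′
primitive-•-unique {k} {k′} {u} {u′} u-prim u′-prim 1≤k k•u≡k′•u′ = k≡k′ , •-cancelˡ 1≤k k•u≡k•u′
  where
  k≡k′ : k ≡ k′
  k≡k′ = ℕDiv.∣-antisym (bezout-•-∣ (primitive⇒bezout u′-prim) (sym k•u≡k′•u′))
                        (bezout-•-∣ (primitive⇒bezout u-prim) k•u≡k′•u′)
  k•u≡k•u′ : k • u ≡ k • u′
  k•u≡k•u′ = trans k•u≡k′•u′ (cong (_• u′) (sym k≡k′))

InCone-primitive : ∀ {m n u u′} → PrimitiveΛ* u → PrimitiveΛ* u′ → 1 ℕ.≤ m →
                   InCone (m • u) (n • u′) → u ≡ u′
InCone-primitive {suc m} {n} {u} {u′} u-prim u′-prim _ (suc p , q , _ , p•m•u≡q•n•u′) =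
  proj₂ (primitive-•-unique {suc p ℕ.* suc m} {q ℕ.* n} u-prim u′-prim (s≤s z≤n)
    (trans (sym (•-assoc (suc p) (suc m) u)) (trans p•m•u≡q•n•u′ (•-assoc q n u′))))

InCone-• : ∀ m n x → 1 ℕ.≤ n → InCone (m • x) (n • x)
InCone-• m n x 1≤n = n , m , 1≤n , •-comm n m x

-- Faces of Minkowski sums

IsMaxPt-•⁻ : ∀ {k} v {A a} → 1 ℕ.≤ k → IsMaxPt (k • v) A a → IsMaxPt v A a
IsMaxPt-•⁻ {suc k} v {A} {a} _ (a∈A , a-max) = a∈A , λ a′ a′∈A →
  ℤP.*-cancelˡ-≤-pos ⟪ v , a′ ⟫ ⟪ v , a ⟫ (+ suc k)
    (subst₂ ℤ._≤_ (⟪⟫-•ˡ (suc k) v a′) (⟪⟫-•ˡ (suc k) v a) (a-max a′ a′∈A))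

IsMaxPt-•⁺ : ∀ k v {A a} → IsMaxPt v A a → IsMaxPt (k • v) A a
IsMaxPt-•⁺ k v {A} {a} (a∈A , a-max) = a∈A , λ a′ a′∈A →
  subst₂ ℤ._≤_ (sym (⟪⟫-•ˡ k v a′)) (sym (⟪⟫-•ˡ k v a)) (ℤP.*-monoˡ-≤-nonNeg (+ k) (a-max a′ a′∈A))

IsMaxPt-≡ : ∀ v {A a b} → IsMaxPt v A a → IsMaxPt v A b → ⟪ v , a ⟫ ≡ ⟪ v , b ⟫
IsMaxPt-≡ v (a∈A , a-max) (b∈A , b-max) = ℤP.≤-antisym (b-max _ a∈A) (a-max _ b∈A)

IsMaxPt-⊖ : ∀ v {A a b} → IsMaxPt v A a → IsMaxPt v A b → ⟪ v , b ⊖ a ⟫ ≡ 0ℤ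
IsMaxPt-⊖ v {A} {a} {b} a-max b-max =
  trans (⟪⟫-⊖ v b a) (ℤP.i≡j⇒i-j≡0 (IsMaxPt-≡ v b-max a-max))

toList-⊞P : ∀ A B → toList (A ⊞P B) ≡ List.cartesianProductWith _⊕_ (toList A) (toList B)
toList-⊞P (a ∷ as) B = cong (List.map (a ⊕_) (toList B) List.++_) (go as)
  where
  go : ∀ as → List.concat (List.map toList (List.map (λ a → List⁺.map (a ⊕_) B) as))
            ≡ List.cartesianProductWith _⊕_ as (toList B)
  go []       = refl
  go (a ∷ as) = cong (List.map (a ⊕_) (toList B) List.++_) (go as)

∈-⊞P⁺ : ∀ {a b} A B → a ∈ toList A → b ∈ toList B → a ⊕ b ∈ toList (A ⊞P B)
∈-⊞P⁺ {a} {b} A B a∈A b∈B = subst (a ⊕ b ∈_) (sym (toList-⊞P A B)) (∈-cartesianProductWith⁺ _⊕_ a∈A b∈B)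

∈-⊞P⁻ : ∀ {c} A B → c ∈ toList (A ⊞P B) → ∃[ a ] ∃[ b ] (a ∈ toList A × b ∈ toList B × c ≡ a ⊕ b)
∈-⊞P⁻ {c} A B c∈A⊞B = ∈-cartesianProductWith⁻ _⊕_ (toList A) (toList B) (subst (c ∈_) (toList-⊞P A B) c∈A⊞B)

IsMaxPt-⊞P⁺ : ∀ v {a b} A B → IsMaxPt v A a → IsMaxPt v B b → IsMaxPt v (A ⊞P B) (a ⊕ b)
IsMaxPt-⊞P⁺ v {a} {b} A B (a∈A , a-max) (b∈B , b-max) = ∈-⊞P⁺ A B a∈A b∈B , bound
  where
  bound : ∀ c → c ∈ toList (A ⊞P B) → ⟪ v , c ⟫ ℤ.≤ ⟪ v , a ⊕ b ⟫
  bound c c∈A⊞B with a′ , b′ , a′∈A , b′∈B , refl ← ∈-⊞P⁻ A B c∈A⊞B =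
    subst₂ ℤ._≤_ (sym (⟪⟫-⊕ v a′ b′)) (sym (⟪⟫-⊕ v a b)) (ℤP.+-mono-≤ (a-max a′ a′∈A) (b-max b′ b′∈B))

IsMaxPt-⊞P⁻ : ∀ v {c} A B → IsMaxPt v (A ⊞P B) c →
              ∃[ a ] ∃[ b ] (IsMaxPt v A a × IsMaxPt v B b × c ≡ a ⊕ b)
IsMaxPt-⊞P⁻ v A B (c∈A⊞B , c-max) with a , b , a∈A , b∈B , refl ← ∈-⊞P⁻ A B c∈A⊞B =
  a , b , (a∈A , a-max) , (b∈B , b-max) , refl
  where
  a-max : ∀ a′ → a′ ∈ toList A → ⟪ v , a′ ⟫ ℤ.≤ ⟪ v , a ⟫
  a-max a′ a′∈A = +-cancelʳ-≤ ⟪ v , b ⟫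
    (subst₂ ℤ._≤_ (⟪⟫-⊕ v a′ b) (⟪⟫-⊕ v a b) (c-max (a′ ⊕ b) (∈-⊞P⁺ A B a′∈A b∈B)))
  b-max : ∀ b′ → b′ ∈ toList B → ⟪ v , b′ ⟫ ℤ.≤ ⟪ v , b ⟫
  b-max b′ b′∈B = +-cancelˡ-≤ ⟪ v , a ⟫
    (subst₂ ℤ._≤_ (⟪⟫-⊕ v a b′) (⟪⟫-⊕ v a b) (c-max (a ⊕ b′) (∈-⊞P⁺ A B a∈A b′∈B)))

private
  lexOrder : TotalOrder _ _ _
  lexOrder = ×-totalOrder ℤP.≤-decTotalOrder ℤP.≤-totalOrder

  module LexExtrema = Data.List.Extrema lexOrder
  open TotalOrder lexOrder using () renaming (_≤_ to _≤ₗₑₓ_)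

-- m is the lexicographic argmax of x ↦ (⟪ v , x ⟫ , f x).
face-argmax : ∀ v (f : Z3 → ℤ) A → ∃[ m ] (IsMaxPt v A m × (∀ c → IsMaxPt v A c → f c ℤ.≤ f m))
face-argmax v f (a ∷ as) = m , (m∈A , m-max) , f-max
  where
  key : Z3 → ℤ × ℤ
  key x = ⟪ v , x ⟫ , f x
  m : Z3
  m = LexExtrema.argmax key a as
  m∈A : m ∈ a ∷ as
  m∈A with LexExtrema.argmax-sel key a as
  ... | inj₁ m≡a  = subst (_∈ a ∷ as) (sym m≡a) (here refl)
  ... | inj₂ m∈as = there m∈as
  below : ∀ c → c ∈ a ∷ as → key c ≤ₗₑₓ key m
  below c (here refl)  = LexExtrema.f[⊥]≤f[argmax] {f = key} a as
  below c (there c∈as) = All.lookup (LexExtrema.f[xs]≤f[argmax] {f = key} a as) c∈as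
  lex⇒≤ : ∀ {c} → key c ≤ₗₑₓ key m → ⟪ v , c ⟫ ℤ.≤ ⟪ v , m ⟫
  lex⇒≤ (inj₁ (c≤m , _)) = c≤m
  lex⇒≤ (inj₂ (c≡m , _)) = ℤP.≤-reflexive c≡m
  lex⇒f≤ : ∀ {c} → ⟪ v , m ⟫ ℤ.≤ ⟪ v , c ⟫ → key c ≤ₗₑₓ key m → f c ℤ.≤ f m
  lex⇒f≤ m≤c (inj₁ (c≤m , c≢m)) = ⊥-elim (c≢m (ℤP.≤-antisym c≤m m≤c))
  lex⇒f≤ _   (inj₂ (_ , fc≤fm)) = fc≤fm
  m-max : ∀ c → c ∈ a ∷ as → ⟪ v , c ⟫ ℤ.≤ ⟪ v , m ⟫
  m-max c c∈A = lex⇒≤ (below c c∈A)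
  f-max : ∀ c → IsMaxPt v (a ∷ as) c → f c ℤ.≤ f m
  f-max c (c∈A , c-max) = lex⇒f≤ (c-max m m∈A) (below c c∈A)

-- Faces along a primitive functional

D⇒LatticeLengthΛ* : ∀ {A v} → D A v → ∃[ k ] LatticeLengthΛ* v k
D⇒LatticeLengthΛ* (_ , _ , _ , _ , _ , _ , _ , _ , k , _ , len) = k , len

module AlongPrimitive {u : Z3} (u-prim : PrimitiveΛ* u) where

  private
    -- Opaque: otherwise the unifier may unfold the gcd computation behind s and r.
    opaque
      bezout : Bezout u
      bezout = primitive⇒bezout u-prim

    u₁ u₂ s r : ℤ
    u₁ = c₁ u
    u₂ = c₂ u
    s = proj₁ bezout
    r = proj₁ (proj₂ bezout)
    su₁+ru₂≡1 : s * u₁ + r * u₂ ≡ 1ℤ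
    su₁+ru₂≡1 = proj₂ (proj₂ bezout)

  -- A linear form on Λ, restricting to a coordinate on ker u with pos d ≡ 1
  -- for the generator d of ker u below.
  pos : Z3 → ℤ
  pos x = s * Y x - r * X x

  pos-⊖ : ∀ x y → pos (x ⊖ y) ≡ pos x - pos y
  pos-⊖ ⟨ a , b , c ⟩ ⟨ p , q , r′ ⟩ = distrib s r a b c p q r′
    where
    distrib : ∀ s r a b c p q r′ →
              s * ((b - q) - (c - r′)) - r * ((a - p) - (c - r′)) ≡ (s * (b - c) - r * (a - c)) - (s * (q - r′) - r * (p - r′))
    distrib = solve-∀

  pos-⊕ : ∀ x y → pos (x ⊕ y) ≡ pos x + pos y
  pos-⊕ ⟨ a , b , c ⟩ ⟨ p , q , r′ ⟩ = distrib s r a b c p q r′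
    where
    distrib : ∀ s r a b c p q r′ →
              s * ((b + q) - (c + r′)) - r * ((a + p) - (c + r′)) ≡ (s * (b - c) - r * (a - c)) + (s * (q - r′) - r * (p - r′))
    distrib = solve-∀

  pos-• : ∀ n x → pos (n • x) ≡ + n * pos x
  pos-• n ⟨ a , b , c ⟩ = factor s r (+ n) a b c
    where
    factor : ∀ s r n a b c → s * (n * b - n * c) - r * (n * a - n * c) ≡ n * (s * (b - c) - r * (a - c))
    factor = solve-∀

  pos-∼ : ∀ x y → x ∼ y → pos x ≡ pos y
  pos-∼ x y x∼y = cong₂ (λ p q → s * q - r * p) (proj₁ (∼⇒XY≡ x y x∼y)) (proj₂ (∼⇒XY≡ x y x∼y))

  -- Solve u₁ X + u₂ Y = 0 using s u₁ + r u₂ = 1.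
  kernel-XY : ∀ z → ⟪ u , z ⟫ ≡ 0ℤ → X z ≡ pos z * - u₂ × Y z ≡ pos z * u₁
  kernel-XY z ⟪u,z⟫≡0 =
    lincomb₂ s (- X z) (X-elim s r u₁ u₂ (X z) (Y z)) u₁X+u₂Y≡0 su₁+ru₂≡1 ,
    lincomb₂ r (- Y z) (Y-elim s r u₁ u₂ (X z) (Y z)) u₁X+u₂Y≡0 su₁+ru₂≡1
    where
    u₁X+u₂Y≡0 : u₁ * X z + u₂ * Y z ≡ 0ℤ
    u₁X+u₂Y≡0 = trans (sym (⟪⟫-XY u z (proj₁ u-prim))) ⟪u,z⟫≡0
    X-elim : ∀ s r a b x y → x - (s * y - r * x) * (- b) ≡ s * ((a * x + b * y) - 0ℤ) + (- x) * ((s * a + r * b) - 1ℤ)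
    X-elim = solve-∀
    Y-elim : ∀ s r a b x y → y - (s * y - r * x) * a ≡ r * ((a * x + b * y) - 0ℤ) + (- y) * ((s * a + r * b) - 1ℤ)
    Y-elim = solve-∀

  kernel-∼ : ∀ z z′ → ⟪ u , z ⟫ ≡ 0ℤ → ⟪ u , z′ ⟫ ≡ 0ℤ → pos z ≡ pos z′ → z ∼ z′
  kernel-∼ z z′ ⟪u,z⟫≡0 ⟪u,z′⟫≡0 pos≡ = XY≡⇒∼ z z′
    (trans (proj₁ (kernel-XY z ⟪u,z⟫≡0)) (trans (cong (_* - u₂) pos≡) (sym (proj₁ (kernel-XY z′ ⟪u,z′⟫≡0)))))
    (trans (proj₂ (kernel-XY z ⟪u,z⟫≡0)) (trans (cong (_* u₁) pos≡) (sym (proj₂ (kernel-XY z′ ⟪u,z′⟫≡0)))))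

  kernel-• : ∀ n z → ⟪ u , z ⟫ ≡ 0ℤ → ⟪ u , n • z ⟫ ≡ 0ℤ
  kernel-• n z ⟪u,z⟫≡0 = trans (⟪⟫-•ʳ n u z) (trans (cong (+ n *_) ⟪u,z⟫≡0) (ℤP.*-zeroʳ (+ n)))

  kernel-•-∼ : ∀ z n e → ⟪ u , z ⟫ ≡ 0ℤ → ⟪ u , e ⟫ ≡ 0ℤ → pos z ≡ + n * pos e → z ∼ (n • e)
  kernel-•-∼ z n e ⟪u,z⟫≡0 ⟪u,e⟫≡0 pos-z≡n*pos-e =
    kernel-∼ z (n • e) ⟪u,z⟫≡0 (kernel-• n e ⟪u,e⟫≡0) (trans pos-z≡n*pos-e (sym (pos-• n e)))

  d d⁻ : Z3
  d  = ⟨ - u₂ , u₁ , 0ℤ ⟩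
  d⁻ = ⟨ u₂ , - u₁ , 0ℤ ⟩

  ⟪u,d⟫≡0 : ⟪ u , d ⟫ ≡ 0ℤ
  ⟪u,d⟫≡0 = cancel u₁ u₂ (c₃ u)
    where
    cancel : ∀ a b c → a * - b + b * a + c * 0ℤ ≡ 0ℤ
    cancel = solve-∀

  ⟪u,d⁻⟫≡0 : ⟪ u , d⁻ ⟫ ≡ 0ℤ
  ⟪u,d⁻⟫≡0 = cancel u₁ u₂ (c₃ u)
    where
    cancel : ∀ a b c → a * b + b * - a + c * 0ℤ ≡ 0ℤ
    cancel = solve-∀

  pos-d : pos d ≡ 1ℤ
  pos-d = trans (rearrange s r u₁ u₂) su₁+ru₂≡1
    where
    rearrange : ∀ s r a b → s * (a - 0ℤ) - r * (- b - 0ℤ) ≡ s * a + r * b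
    rearrange = solve-∀

  pos-d⁻ : pos d⁻ ≡ - 1ℤ
  pos-d⁻ = trans (rearrange s r u₁ u₂) (cong -_ su₁+ru₂≡1)
    where
    rearrange : ∀ s r a b → s * (- a - 0ℤ) - r * (b - 0ℤ) ≡ - (s * a + r * b)
    rearrange = solve-∀

  pos-zero3 : pos zero3 ≡ 0ℤ
  pos-zero3 = vanish s r
    where
    vanish : ∀ s r → s * 0ℤ - r * 0ℤ ≡ 0ℤ
    vanish = solve-∀

  kernel-•d : ∀ z n → ⟪ u , z ⟫ ≡ 0ℤ → pos z ≡ + n → z ∼ (n • d)
  kernel-•d z n ⟪u,z⟫≡0 pos-z≡n = kernel-•-∼ z n d ⟪u,z⟫≡0 ⟪u,d⟫≡0 (begin
    pos z          ≡⟨ pos-z≡n ⟩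
    + n            ≡⟨ ℤP.*-identityʳ (+ n) ⟨
    + n * 1ℤ       ≡⟨ cong (+ n *_) pos-d ⟨
    + n * pos d    ∎)
    where open ≡-Reasoning

  kernel-•d⁻ : ∀ z n → ⟪ u , z ⟫ ≡ 0ℤ → pos z ≡ - + n → z ∼ (n • d⁻)
  kernel-•d⁻ z n ⟪u,z⟫≡0 pos-z≡-n = kernel-•-∼ z n d⁻ ⟪u,z⟫≡0 ⟪u,d⁻⟫≡0 (begin
    pos z          ≡⟨ pos-z≡-n ⟩
    - + n          ≡⟨ neg-as-* (+ n) ⟩
    + n * - 1ℤ     ≡⟨ cong (+ n *_) pos-d⁻ ⟨
    + n * pos d⁻   ∎)
    where
    open ≡-Reasoning
    neg-as-* : ∀ m → - m ≡ m * - 1ℤ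
    neg-as-* = solve-∀

  d-primitive : PrimitiveΛ d
  d-primitive = d≁0 , d-indivisible
    where
    d≁0 : ¬ (d ∼ zero3)
    d≁0 d∼0 with () ← trans (sym pos-d) (trans (pos-∼ d zero3 d∼0) pos-zero3)
    d-indivisible : ¬ (∃[ μ ] ∃[ z ] (2 ℕ.≤ μ × d ∼ (μ • z)))
    d-indivisible (μ , z , 2≤μ , d∼μz) = 2≤m⇒1≢m*n ∣ pos z ∣ 2≤μ (begin
      1                    ≡⟨ cong ∣_∣ pos-d ⟨
      ∣ pos d ∣            ≡⟨ cong ∣_∣ (trans (pos-∼ d (μ • z) d∼μz) (pos-• μ z)) ⟩
      ∣ + μ * pos z ∣      ≡⟨ ℤP.abs-* (+ μ) (pos z) ⟩
      μ ℕ.* ∣ pos z ∣      ∎)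
      where open ≡-Reasoning

  -- y ∼ n • d or y ∼ n • d⁻ with n = ∣ pos y ∣, so primitivity forces n ≡ 1.
  primitive⇒∣pos∣≡1 : ∀ y → ⟪ u , y ⟫ ≡ 0ℤ → PrimitiveΛ y → ∣ pos y ∣ ≡ 1
  primitive⇒∣pos∣≡1 y ⟪u,y⟫≡0 (y≁0 , y-indivisible) with pos y in pos-y≡
  ... | + 0          = ⊥-elim (y≁0 (kernel-•d y 0 ⟪u,y⟫≡0 pos-y≡))
  ... | + 1          = refl
  ... | + suc (suc n) =
    ⊥-elim (y-indivisible (suc (suc n) , d , s≤s (s≤s z≤n) , kernel-•d y (suc (suc n)) ⟪u,y⟫≡0 pos-y≡))
  ... | -[1+ 0 ]     = refl
  ... | -[1+ suc n ] =
    ⊥-elim (y-indivisible (suc (suc n) , d⁻ , s≤s (s≤s z≤n) , kernel-•d⁻ y (suc (suc n)) ⟪u,y⟫≡0 pos-y≡))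

  LatticeLengthΛ-kernel⁺ : ∀ z k → ⟪ u , z ⟫ ≡ 0ℤ → 1 ℕ.≤ k → pos z ≡ + k → LatticeLengthΛ z k
  LatticeLengthΛ-kernel⁺ z k ⟪u,z⟫≡0 1≤k pos-z≡k = 1≤k , d , d-primitive , kernel-•d z k ⟪u,z⟫≡0 pos-z≡k

  LatticeLengthΛ-kernel⁻ : ∀ z k → ⟪ u , z ⟫ ≡ 0ℤ → LatticeLengthΛ z k → ∣ pos z ∣ ≡ k
  LatticeLengthΛ-kernel⁻ z (suc k) ⟪u,z⟫≡0 (_ , y , y-prim , z∼ky) = begin
    ∣ pos z ∣                ≡⟨ cong ∣_∣ (trans (pos-∼ z (suc k • y) z∼ky) (pos-• (suc k) y)) ⟩
    ∣ + suc k * pos y ∣      ≡⟨ ℤP.abs-* (+ suc k) (pos y) ⟩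
    suc k ℕ.* ∣ pos y ∣      ≡⟨ cong (suc k ℕ.*_) (primitive⇒∣pos∣≡1 y ⟪u,y⟫≡0 y-prim) ⟩
    suc k ℕ.* 1              ≡⟨ ℕP.*-identityʳ (suc k) ⟩
    suc k                    ∎
    where
    open ≡-Reasoning
    ⟪u,y⟫≡0 : ⟪ u , y ⟫ ≡ 0ℤ
    ⟪u,y⟫≡0 = ℤP.*-cancelˡ-≡ (+ suc k) ⟪ u , y ⟫ 0ℤ (begin
      + suc k * ⟪ u , y ⟫    ≡⟨ ⟪⟫-•ʳ (suc k) u y ⟨
      ⟪ u , suc k • y ⟫      ≡⟨ ⟪⟫-∼ u {z} {suc k • y} (proj₁ u-prim) z∼ky ⟨
      ⟪ u , z ⟫              ≡⟨ ⟪u,z⟫≡0 ⟩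
      0ℤ                     ≡⟨ ℤP.*-zeroʳ (+ suc k) ⟨
      + suc k * 0ℤ           ∎)

  -- S(conv A, u) is a segment [lo, hi] ⊆ lo + ker u of lattice length w
  -- (a point when w ≡ 0).
  record FaceWidth (A : Polytope) (w : ℕ) : Set where
    field
      lo hi   : Z3
      lo-max  : IsMaxPt u A lo
      hi-max  : IsMaxPt u A hi
      hi-lo   : pos hi - pos lo ≡ + w
      bounded : ∀ c → IsMaxPt u A c → pos lo ℤ.≤ pos c × pos c ℤ.≤ pos hi

  faceWidth : ∀ A → ∃[ w ] FaceWidth A w
  faceWidth A
    with hi , hi-max , hi-top ← face-argmax u pos A
       | lo , lo-max , lo-bottom ← face-argmax u (λ x → - pos x) A =
    ∣ pos hi - pos lo ∣ , record
      { lo = lo ; hi = hi ; lo-max = lo-max ; hi-max = hi-max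
      ; hi-lo = i≤j⇒j-i≡+∣j-i∣ (hi-top lo lo-max)
      ; bounded = λ c c-max → ℤP.neg-cancel-≤ (lo-bottom c c-max) , hi-top c c-max
      }

  faceWidth-unique : ∀ {A w w′} → FaceWidth A w → FaceWidth A w′ → w ≡ w′
  faceWidth-unique W W′ = ℤP.+-injective (begin
    + _                      ≡⟨ W.hi-lo ⟨
    pos W.hi - pos W.lo      ≡⟨ cong₂ _-_ hi≡hi′ lo≡lo′ ⟩
    pos W′.hi - pos W′.lo    ≡⟨ W′.hi-lo ⟩
    + _                      ∎)
    where
    open ≡-Reasoning
    module W = FaceWidth W
    module W′ = FaceWidth W′
    hi≡hi′ : pos W.hi ≡ pos W′.hi
    hi≡hi′ = ℤP.≤-antisym (proj₂ (W′.bounded W.hi W.hi-max)) (proj₂ (W.bounded W′.hi W′.hi-max))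
    lo≡lo′ : pos W.lo ≡ pos W′.lo
    lo≡lo′ = ℤP.≤-antisym (proj₁ (W.bounded W′.lo W′.lo-max)) (proj₁ (W′.bounded W.lo W.lo-max))

  width : Polytope → ℕ
  width A = proj₁ (faceWidth A)

  FaceWidth⇒width≡ : ∀ {A w} → FaceWidth A w → width A ≡ w
  FaceWidth⇒width≡ {A} = faceWidth-unique (proj₂ (faceWidth A))

  faceWidth-⊞P : ∀ {A B m n} → FaceWidth A m → FaceWidth B n → FaceWidth (A ⊞P B) (m ℕ.+ n)
  faceWidth-⊞P {A} {B} {m} {n} W W′ = record
    { lo = W.lo ⊕ W′.lo ; hi = W.hi ⊕ W′.hi
    ; lo-max = IsMaxPt-⊞P⁺ u A B W.lo-max W′.lo-max
    ; hi-max = IsMaxPt-⊞P⁺ u A B W.hi-max W′.hi-max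
    ; hi-lo = hi-lo
    ; bounded = bounded
    }
    where
    module W = FaceWidth W
    module W′ = FaceWidth W′
    open ≡-Reasoning
    interchange : ∀ a b c d → (a + b) - (c + d) ≡ (a - c) + (b - d)
    interchange = solve-∀
    hi-lo : pos (W.hi ⊕ W′.hi) - pos (W.lo ⊕ W′.lo) ≡ + (m ℕ.+ n)
    hi-lo = begin
      pos (W.hi ⊕ W′.hi) - pos (W.lo ⊕ W′.lo)            ≡⟨ cong₂ _-_ (pos-⊕ W.hi W′.hi) (pos-⊕ W.lo W′.lo) ⟩
      (pos W.hi + pos W′.hi) - (pos W.lo + pos W′.lo)    ≡⟨ interchange (pos W.hi) (pos W′.hi) (pos W.lo) (pos W′.lo) ⟩
      (pos W.hi - pos W.lo) + (pos W′.hi - pos W′.lo)    ≡⟨ cong₂ _+_ W.hi-lo W′.hi-lo ⟩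
      + m + + n                                          ≡⟨ ℤP.pos-+ m n ⟨
      + (m ℕ.+ n)                                        ∎
    bounded : ∀ c → IsMaxPt u (A ⊞P B) c →
              pos (W.lo ⊕ W′.lo) ℤ.≤ pos c × pos c ℤ.≤ pos (W.hi ⊕ W′.hi)
    bounded c c-max with a , b , a-max , b-max , refl ← IsMaxPt-⊞P⁻ u A B c-max =
      subst₂ ℤ._≤_ (sym (pos-⊕ W.lo W′.lo)) (sym (pos-⊕ a b))
        (ℤP.+-mono-≤ (proj₁ (W.bounded a a-max)) (proj₁ (W′.bounded b b-max))) ,
      subst₂ ℤ._≤_ (sym (pos-⊕ a b)) (sym (pos-⊕ W.hi W′.hi))
        (ℤP.+-mono-≤ (proj₂ (W.bounded a a-max)) (proj₂ (W′.bounded b b-max)))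

  width-⊞P : ∀ A B → width (A ⊞P B) ≡ width A ℕ.+ width B
  width-⊞P A B = FaceWidth⇒width≡ (faceWidth-⊞P (proj₂ (faceWidth A)) (proj₂ (faceWidth B)))

  InSegment⇒pos : ∀ c a b → InSegment c a b → ConvexCombination (pos c) (pos a) (pos b)
  InSegment⇒pos c a b (p , q , 0<q , p≤q , q[c-a]∼p[b-a]) = p , q , 0<q , p≤q , (begin
    + q * (pos c - pos a)   ≡⟨ cong (+ q *_) (pos-⊖ c a) ⟨
    + q * pos (c ⊖ a)       ≡⟨ pos-• q (c ⊖ a) ⟨
    pos (q • (c ⊖ a))       ≡⟨ pos-∼ (q • (c ⊖ a)) (p • (b ⊖ a)) q[c-a]∼p[b-a] ⟩
    pos (p • (b ⊖ a))       ≡⟨ pos-• p (b ⊖ a) ⟩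
    + p * pos (b ⊖ a)       ≡⟨ cong (+ p *_) (pos-⊖ b a) ⟩
    + p * (pos b - pos a)   ∎)
    where open ≡-Reasoning

  segment⇒FaceWidth : ∀ {A k a b} → IsMaxPt u A a → IsMaxPt u A b → ∣ pos b - pos a ∣ ≡ k →
                      (∀ c → IsMaxPt u A c → InSegment c a b) → FaceWidth A k
  segment⇒FaceWidth {A} {k} {a} {b} a-max b-max ∣b-a∣≡k segment with ℤP.≤-total (pos a) (pos b)
  ... | inj₁ a≤b = record
    { lo = a ; hi = b ; lo-max = a-max ; hi-max = b-max
    ; hi-lo = trans (i≤j⇒j-i≡+∣j-i∣ a≤b) (cong +_ ∣b-a∣≡k)
    ; bounded = bounded
    }
    where
    bounded : ∀ c → IsMaxPt u A c → pos a ℤ.≤ pos c × pos c ℤ.≤ pos b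
    bounded c c-max = between (InSegment⇒pos c a b (segment c c-max)) a≤b
  ... | inj₂ b≤a = record
    { lo = b ; hi = a ; lo-max = b-max ; hi-max = a-max
    ; hi-lo = trans (i≤j⇒j-i≡+∣j-i∣ b≤a) (cong +_ (trans (ℤP.∣i-j∣≡∣j-i∣ (pos a) (pos b)) ∣b-a∣≡k))
    ; bounded = bounded
    }
    where
    bounded : ∀ c → IsMaxPt u A c → pos b ℤ.≤ pos c × pos c ℤ.≤ pos a
    bounded c c-max = between-reversed (InSegment⇒pos c a b (segment c c-max)) b≤a

  edge⇒FaceWidth : ∀ {A k} → 1 ℕ.≤ k → EdgeOfLength A (k • u) → FaceWidth A k
  edge⇒FaceWidth {A} {k} 1≤k (a , b , a-max , b-max , _ , segment , k′ , len-b-a , _ , u′ , u′-prim , ku≡k′u′) =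
    segment⇒FaceWidth a-max′ b-max′ ∣b-a∣≡k (λ c c-max → segment c (IsMaxPt-•⁺ k u c-max))
    where
    k≡k′ : k ≡ k′
    k≡k′ = proj₁ (primitive-•-unique {k} {k′} {u} {u′} u-prim u′-prim 1≤k ku≡k′u′)
    a-max′ : IsMaxPt u A a
    a-max′ = IsMaxPt-•⁻ u 1≤k a-max
    b-max′ : IsMaxPt u A b
    b-max′ = IsMaxPt-•⁻ u 1≤k b-max
    ∣b-a∣≡k : ∣ pos b - pos a ∣ ≡ k
    ∣b-a∣≡k = begin
      ∣ pos b - pos a ∣    ≡⟨ cong ∣_∣ (pos-⊖ b a) ⟨
      ∣ pos (b ⊖ a) ∣      ≡⟨ LatticeLengthΛ-kernel⁻ (b ⊖ a) k′ (IsMaxPt-⊖ u a-max′ b-max′) len-b-a ⟩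
      k′                   ≡⟨ k≡k′ ⟨
      k                    ∎
      where open ≡-Reasoning

  -- With p = pos c - pos lo, both k • (c ⊖ lo) and p • (hi ⊖ lo) lie in ker u at position k * p.
  FaceWidth⇒InSegment : ∀ {A k} → 1 ℕ.≤ k → (W : FaceWidth A k) →
                        ∀ c → IsMaxPt u A c → InSegment c (FaceWidth.lo W) (FaceWidth.hi W)
  FaceWidth⇒InSegment {A} {k} 1≤k W c c-max = p , k , 1≤k , p≤k ,
    kernel-∼ (k • (c ⊖ lo)) (p • (hi ⊖ lo))
      (kernel-• k (c ⊖ lo) (IsMaxPt-⊖ u lo-max c-max)) (kernel-• p (hi ⊖ lo) (IsMaxPt-⊖ u lo-max hi-max))
      (begin
        pos (k • (c ⊖ lo))      ≡⟨ pos-• k (c ⊖ lo) ⟩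
        + k * pos (c ⊖ lo)      ≡⟨ cong (+ k *_) (trans (pos-⊖ c lo) c-lo≡p) ⟩
        + k * + p               ≡⟨ ℤP.*-comm (+ k) (+ p) ⟩
        + p * + k               ≡⟨ cong (+ p *_) (trans (pos-⊖ hi lo) hi-lo) ⟨
        + p * pos (hi ⊖ lo)     ≡⟨ pos-• p (hi ⊖ lo) ⟨
        pos (p • (hi ⊖ lo))     ∎)
    where
    open FaceWidth W
    open ≡-Reasoning
    p : ℕ
    p = ∣ pos c - pos lo ∣
    c-lo≡p : pos c - pos lo ≡ + p
    c-lo≡p = i≤j⇒j-i≡+∣j-i∣ (proj₁ (bounded c c-max))
    p≤k : p ℕ.≤ k
    p≤k = ℤP.drop‿+≤+ (subst₂ ℤ._≤_ c-lo≡p hi-lo (ℤP.+-monoˡ-≤ (- pos lo) (proj₂ (bounded c c-max))))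

  FaceWidth⇒edge : ∀ {A k} → 1 ℕ.≤ k → FaceWidth A k → EdgeOfLength A (k • u)
  FaceWidth⇒edge {A} {k} 1≤k W =
    lo , hi , IsMaxPt-•⁺ k u lo-max , IsMaxPt-•⁺ k u hi-max , lo≁hi ,
    (λ c c-max → FaceWidth⇒InSegment 1≤k W c (IsMaxPt-•⁻ u 1≤k c-max)) ,
    k , LatticeLengthΛ-kernel⁺ (hi ⊖ lo) k (IsMaxPt-⊖ u lo-max hi-max) 1≤k (trans (pos-⊖ hi lo) hi-lo) ,
    1≤k , u , u-prim , refl
    where
    open FaceWidth W
    lo≁hi : ¬ (lo ∼ hi)
    lo≁hi lo∼hi = ℕP.<⇒≢ 1≤k (sym (ℤP.+-injective (begin
      + k                  ≡⟨ hi-lo ⟨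
      pos hi - pos lo      ≡⟨ ℤP.i≡j⇒i-j≡0 (sym (pos-∼ lo hi lo∼hi)) ⟩
      + 0                  ∎)))
      where open ≡-Reasoning

  D⇒width≡ : ∀ A {k} → 1 ℕ.≤ k → D A (k • u) → width A ≡ k
  D⇒width≡ A 1≤k (_ , _ , edge) = FaceWidth⇒width≡ (edge⇒FaceWidth 1≤k edge)

  width≡⇒D : ∀ A {k} → 1 ℕ.≤ k → width A ≡ k → D A (k • u)
  width≡⇒D A {k} 1≤k refl =
    InΛ*-• k (proj₁ u-prim) , •-≢zero3 1≤k (proj₁ (proj₂ u-prim)) , FaceWidth⇒edge 1≤k (proj₂ (faceWidth A))

  width≡0⇒¬InCone : ∀ A {k} → width A ≡ 0 → ∀ v → D A v → ¬ InCone v (k • u)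
  width≡0⇒¬InCone A {k} width≡0 v DA = aligned (D⇒LatticeLengthΛ* DA) DA
    where
    aligned : ∀ {v} → ∃[ m ] LatticeLengthΛ* v m → D A v → ¬ InCone v (k • u)
    aligned (m , 1≤m , u′ , u′-prim , refl) DA v∈cone =
      ℕP.<⇒≢ 1≤m (trans (sym width≡0) (D⇒width≡ A 1≤m (subst (λ u″ → D A (m • u″)) u′≡u DA)))
      where
      u′≡u : u′ ≡ u
      u′≡u = InCone-primitive {m} {k} {u′} {u} u′-prim u-prim 1≤m v∈cone

  ¬InCone⇒width≡0 : ∀ A {k} → 1 ℕ.≤ k → (∀ v → D A v → ¬ InCone v (k • u)) → width A ≡ 0
  ¬InCone⇒width≡0 A {k} 1≤k outside-cone = zero-if (width A) refl
    where
    zero-if : ∀ n → width A ≡ n → width A ≡ 0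
    zero-if zero    width≡0 = width≡0
    zero-if (suc n) width≡n =
      ⊥-elim (outside-cone (suc n • u) (width≡⇒D A (s≤s z≤n) width≡n) (InCone-• (suc n) k u 1≤k))

  widths⇒D-⊞P : ∀ P Q {k} → 1 ℕ.≤ k → width P ℕ.+ width Q ≡ k → D (P ⊞P Q) (k • u)
  widths⇒D-⊞P P Q 1≤k widths = width≡⇒D (P ⊞P Q) 1≤k (trans (width-⊞P P Q) widths)

  widths⇒D⊞D : ∀ P Q {k} m n → 1 ℕ.≤ k → width P ≡ m → width Q ≡ n → m ℕ.+ n ≡ k →
               (D P ⊞ D Q) (k • u)
  widths⇒D⊞D P Q {k} zero n 1≤k width≡0 width≡n n≡k =
    inj₂ (inj₂ (width≡⇒D Q 1≤k (trans width≡n n≡k) , width≡0⇒¬InCone P {k} width≡0))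
  widths⇒D⊞D P Q {k} (suc m) zero 1≤k width≡m width≡0 m+0≡k =
    inj₂ (inj₁ (width≡⇒D P 1≤k (trans width≡m (trans (sym (ℕP.+-identityʳ (suc m))) m+0≡k)) ,
                width≡0⇒¬InCone Q {k} width≡0))
  widths⇒D⊞D P Q {k} (suc m) (suc n) 1≤k width≡m width≡n m+n≡k =
    inj₁ (suc m • u , suc n • u , width≡⇒D P (s≤s z≤n) width≡m , width≡⇒D Q (s≤s z≤n) width≡n ,
          (InCone-• (suc m) (suc n) u (s≤s z≤n) , InCone-• (suc n) (suc m) u (s≤s z≤n)) ,
          trans (cong (_• u) (sym m+n≡k)) (•-distribʳ-+ (suc m) (suc n) u))

  D-⊞P⇒D⊞D : ∀ P Q {k} → 1 ℕ.≤ k → D (P ⊞P Q) (k • u) → (D P ⊞ D Q) (k • u)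
  D-⊞P⇒D⊞D P Q 1≤k D-sum = widths⇒D⊞D P Q (width P) (width Q) 1≤k refl refl
    (trans (sym (width-⊞P P Q)) (D⇒width≡ (P ⊞P Q) 1≤k D-sum))

  D⊞D-aligned⇒D-⊞P : ∀ P Q {m n u′} → 1 ℕ.≤ m → 1 ℕ.≤ n → u ≡ u′ →
                      D P (m • u) → D Q (n • u′) → D (P ⊞P Q) ((m • u) ⊕ (n • u′))
  D⊞D-aligned⇒D-⊞P P Q {m} {n} 1≤m 1≤n refl DP DQ =
    subst (D (P ⊞P Q)) (•-distribʳ-+ m n u)
      (widths⇒D-⊞P P Q (ℕP.≤-trans 1≤m (ℕP.m≤m+n m n)) (cong₂ ℕ._+_ (D⇒width≡ P 1≤m DP) (D⇒width≡ Q 1≤n DQ)))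

  D⊞D-left⇒D-⊞P : ∀ P Q {k} → 1 ℕ.≤ k → D P (k • u) → (∀ w → D Q w → ¬ InCone w (k • u)) →
                   D (P ⊞P Q) (k • u)
  D⊞D-left⇒D-⊞P P Q {k} 1≤k DP outside-cone = widths⇒D-⊞P P Q 1≤k (begin
    width P ℕ.+ width Q   ≡⟨ cong₂ ℕ._+_ (D⇒width≡ P 1≤k DP) (¬InCone⇒width≡0 Q 1≤k outside-cone) ⟩
    k ℕ.+ 0               ≡⟨ ℕP.+-identityʳ k ⟩
    k                     ∎)
    where open ≡-Reasoning

  D⊞D-right⇒D-⊞P : ∀ P Q {k} → 1 ℕ.≤ k → D Q (k • u) → (∀ v → D P v → ¬ InCone v (k • u)) →
                    D (P ⊞P Q) (k • u)
  D⊞D-right⇒D-⊞P P Q 1≤k DQ outside-cone =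
    widths⇒D-⊞P P Q 1≤k (cong₂ ℕ._+_ (¬InCone⇒width≡0 P 1≤k outside-cone) (D⇒width≡ Q 1≤k DQ))

-- x ≡ k • u is matched in a clause: a with-abstraction would normalise the
-- goals about P ⊞P Q into a form the unifier fails to compare.
D-⊞P⁻ : ∀ P Q x → D (P ⊞P Q) x → (D P ⊞ D Q) x
D-⊞P⁻ P Q x D-sum = along (D⇒LatticeLengthΛ* D-sum) D-sum
  where
  along : ∀ {x} → ∃[ k ] LatticeLengthΛ* x k → D (P ⊞P Q) x → (D P ⊞ D Q) x
  along (_ , 1≤k , u , u-prim , refl) = AlongPrimitive.D-⊞P⇒D⊞D u-prim P Q 1≤k

D-⊞P⁺ : ∀ P Q x → (D P ⊞ D Q) x → D (P ⊞P Q) x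
D-⊞P⁺ P Q _ (inj₁ (v , w , DP , DQ , (v∈cone-w , _) , refl)) =
  along (D⇒LatticeLengthΛ* DP) (D⇒LatticeLengthΛ* DQ) DP DQ v∈cone-w
  where
  along : ∀ {v w} → ∃[ m ] LatticeLengthΛ* v m → ∃[ n ] LatticeLengthΛ* w n →
          D P v → D Q w → InCone v w → D (P ⊞P Q) (v ⊕ w)
  along (m , 1≤m , u , u-prim , refl) (n , 1≤n , u′ , u′-prim , refl) DP DQ v∈cone-w =
    AlongPrimitive.D⊞D-aligned⇒D-⊞P u-prim P Q 1≤m 1≤n
      (InCone-primitive {m} {n} {u} {u′} u-prim u′-prim 1≤m v∈cone-w) DP DQ
D-⊞P⁺ P Q x (inj₂ (inj₁ (DP , outside-cone))) = along (D⇒LatticeLengthΛ* DP) DP outside-cone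
  where
  along : ∀ {x} → ∃[ k ] LatticeLengthΛ* x k → D P x → (∀ w → D Q w → ¬ InCone w x) → D (P ⊞P Q) x
  along (_ , 1≤k , u , u-prim , refl) = AlongPrimitive.D⊞D-left⇒D-⊞P u-prim P Q 1≤k
D-⊞P⁺ P Q x (inj₂ (inj₂ (DQ , outside-cone))) = along (D⇒LatticeLengthΛ* DQ) DQ outside-cone
  where
  along : ∀ {x} → ∃[ k ] LatticeLengthΛ* x k → D Q x → (∀ v → D P v → ¬ InCone v x) → D (P ⊞P Q) x
  along (_ , 1≤k , u , u-prim , refl) = AlongPrimitive.D⊞D-right⇒D-⊞P u-prim P Q 1≤k

mainTheorem3 : (P Q : Polytope) (x : Z3) →
    (D (P ⊞P Q) x → (D P ⊞ D Q) x) × ((D P ⊞ D Q) x → D (P ⊞P Q) x)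
mainTheorem3 P Q x = D-⊞P⁻ P Q x , D-⊞P⁺ P Q x
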